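{- Let $S$ be a discrete valuation ring with maximal ideal generated by $s$, let $p$ be a prime, and let $\alpha_0,\dots,\alpha_{p-1}\ge0$ be integers. Let \[ M:=\Big\{(x_h)_{h\in[0,p-1]}\in S^p:\ \mathrm{val}_s\Big(\sum_{h=0}^l(-1)^h\tbinom lh x_h\Big)\ge\alpha_l\ \text{for all }l\in[0,p-1]\Big\}\subseteq S^p. \] Then the tuples $\big(s^{\alpha_l}\binom il\big)_{i\in[0,p-1]}$, $l\in[0,p-1]$, form an $S$-linear basis of $M$.
   Context: $\mathrm{val}_s$ is the normalized valuation, $\mathrm{val}_s(0)=+\infty$; $\binom ab=0$ unless $0\le b\le a$. -}

module Defs where

open import Level using (_⊔_)
open import Data.Nat using (ℕ; zero; suc)
open import Data.Nat.Combinatorics using (_C_)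
open import Data.Fin using (Fin; zero; suc; toℕ)
open import Data.Product using (Σ; ∃; _×_)
open import Data.Sum using (_⊎_)
open import Relation.Nullary using (¬_)
open import Algebra.Bundles using (CommutativeRing)

module Ops {c ℓ} (R : CommutativeRing c ℓ) where
  open CommutativeRing R hiding (zero)

  pow : Carrier → ℕ → Carrier
  pow x zero = 1#
  pow x (suc n) = x * pow x n

  natMul : ℕ → Carrier → Carrier
  natMul zero x = 0#
  natMul (suc n) x = x + natMul n x

  nat : ℕ → Carrier
  nat n = natMul n 1#

  signMul : ℕ → Carrier → Carrier
  signMul zero x = x
  signMul (suc h) x = - signMul h x

  sumFin : (n : ℕ) → (Fin n → Carrier) → Carrier
  sumFin zero f = 0#
  sumFin (suc n) f = f zero + sumFin n (λ i → f (suc i))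

  IsUnit : Carrier → Set (c ⊔ ℓ)
  IsUnit u = Σ Carrier λ v → u * v ≈ 1#

  -- val_s(y) ≥ a, i.e. s^a divides y (for y = 0 this holds, val_s(0) = +∞)
  ValGe : Carrier → Carrier → ℕ → Set (c ⊔ ℓ)
  ValGe s y a = Σ Carrier λ z → y ≈ z * pow s a

  record IsDVR (s : Carrier) : Set (c ⊔ ℓ) where
    field
      nontrivial : ¬ (1# ≈ 0#)
      noZeroDiv  : ∀ x y → x * y ≈ 0# → x ≈ 0# ⊎ y ≈ 0#
      s≉0        : ¬ (s ≈ 0#)
      s-nonunit  : ¬ IsUnit s
      factor     : ∀ x → ¬ (x ≈ 0#) → Σ ℕ λ n → Σ Carrier λ u → IsUnit u × (x ≈ u * pow s n)

  InM : Carrier → (p : ℕ) → (Fin p → ℕ) → (Fin p → Carrier) → Set (c ⊔ ℓ)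
  InM s p α x = ∀ (l : Fin p) →
    ValGe s (sumFin p (λ h → signMul (toℕ h) (nat (toℕ l C toℕ h) * x h))) (α l)

  vec : Carrier → (p : ℕ) → (Fin p → ℕ) → Fin p → Fin p → Carrier
  vec s p α l i = pow s (α l) * nat (toℕ i C toℕ l)

  IsBasis : (p : ℕ) → ((Fin p → Carrier) → Set (c ⊔ ℓ)) → (Fin p → Fin p → Carrier) → Set (c ⊔ ℓ)
  IsBasis p P v =
      (∀ l → P (v l))
    × (∀ (a : Fin p → Carrier) → (∀ i → sumFin p (λ l → a l * v l i) ≈ 0#) → ∀ l → a l ≈ 0#)
    × (∀ x → P x → Σ (Fin p → Carrier) λ a → ∀ i → x i ≈ sumFin p (λ l → a l * v l i))

{-# OPTIONS --safe #-}

-- Write (Δ x)_m = Σ_h (-1)^h C(m,h) x_h. Pascal's rule gives the binomial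
-- orthogonality Σ_h (-1)^h C(m,h) C(h,l) = (-1)^m δ_{ml}, so Δ is an involution
-- of S^p. Membership in M says that s^{α_l} divides (Δ x)_l, while
-- Σ_l a_l v_l = Δ((-1)^l a_l s^{α_l}). Hence Δ maps the span of the v_l onto M,
-- and the v_l are independent because Δ is injective and the powers of s are
-- not zero divisors.

module Submission where

open import Defs
open import Data.Nat as ℕ using (ℕ; zero; suc; _<_; s≤s)
open import Data.Nat.Properties using (m<n⇒m<1+n)
open import Data.Nat.Combinatorics using (_C_; nCk+nC[k+1]≡[n+1]C[k+1])
open import Data.Nat.Primality using (Prime)
open import Data.Fin using (Fin; zero; suc; toℕ; punchIn)
open import Data.Fin.Properties using (toℕ<n; toℕ-injective; punchInᵢ≢i)
open import Data.Product using (Σ; _,_; proj₁; proj₂)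
open import Data.Sum using (inj₁; inj₂)
open import Function using (_∘_)
open import Relation.Nullary using (¬_; contradiction)
open import Relation.Binary.PropositionalEquality as ≡ using (_≡_; _≢_)
open import Algebra.Bundles using (CommutativeRing)
import Algebra.Solver.Ring.NaturalCoefficients.Default as SemiringSolver

module BinomialTransform {c ℓ} (R : CommutativeRing c ℓ) where
  open CommutativeRing R hiding (zero)
  open Ops R
  open import Algebra.Properties.Ring ring using (-‿distribˡ-*; -‿distribʳ-*; -‿involutive)
  open import Algebra.Properties.AbelianGroup +-abelianGroup using (⁻¹-∙-comm)
  open import Algebra.Properties.Semiring.Sum semiring
    using (sum; sum-syntax; sum-cong-≋; sum-replicate-zero; sum-remove;
           ∑-comm; ∑-distrib-+; *-distribˡ-sum)
  open import Relation.Binary.Reasoning.Setoid setoid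
  open SemiringSolver commutativeSemiring using (solve; _:=_; _:+_; _:*_)

  sumFin≡sum : ∀ n (f : Fin n → Carrier) → sumFin n f ≡ sum f
  sumFin≡sum zero    f = ≡.refl
  sumFin≡sum (suc n) f = ≡.cong (f zero +_) (sumFin≡sum n (f ∘ suc))

  sum-zero : ∀ {n} (f : Fin n → Carrier) → (∀ i → f i ≈ 0#) → sum f ≈ 0#
  sum-zero {n} f f≈0 = trans (sum-cong-≋ f≈0) (sum-replicate-zero n)

  sum-single : ∀ {n} (f : Fin n → Carrier) i → (∀ j → j ≢ i → f j ≈ 0#) → sum f ≈ f i
  sum-single {suc n} f i f≈0 = begin
    sum f                      ≈⟨ sum-remove f ⟩
    f i + sum (f ∘ punchIn i)  ≈⟨ +-congˡ (sum-zero _ (λ j → f≈0 _ (punchInᵢ≢i i j))) ⟩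
    f i + 0#                   ≈⟨ +-identityʳ (f i) ⟩
    f i                        ∎

  x+y≈z⇒x≈z-y : ∀ {x y z} → x + y ≈ z → x ≈ z - y
  x+y≈z⇒x≈z-y {x} {y} {z} x+y≈z = begin
    x             ≈⟨ +-identityʳ x ⟨
    x + 0#        ≈⟨ +-congˡ (-‿inverseʳ y) ⟨
    x + (y - y)   ≈⟨ +-assoc x y (- y) ⟨
    (x + y) - y   ≈⟨ +-congʳ x+y≈z ⟩
    z - y         ∎

  sgn : ℕ → Carrier
  sgn h = signMul h 1#

  signMul≈sgn* : ∀ h x → signMul h x ≈ sgn h * x
  signMul≈sgn* zero    x = sym (*-identityˡ x)
  signMul≈sgn* (suc h) x = trans (-‿cong (signMul≈sgn* h x)) (-‿distribˡ-* (sgn h) x)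

  sgn*sgn≈1 : ∀ h → sgn h * sgn h ≈ 1#
  sgn*sgn≈1 zero    = *-identityˡ 1#
  sgn*sgn≈1 (suc h) = begin
    - sgn h * - sgn h     ≈⟨ -‿distribˡ-* (sgn h) (- sgn h) ⟨
    - (sgn h * - sgn h)   ≈⟨ -‿cong (-‿distribʳ-* (sgn h) (sgn h)) ⟨
    - - (sgn h * sgn h)   ≈⟨ -‿involutive _ ⟩
    sgn h * sgn h         ≈⟨ sgn*sgn≈1 h ⟩
    1#                    ∎

  sgn-cancel : ∀ h x → sgn h * (sgn h * x) ≈ x
  sgn-cancel h x = begin
    sgn h * (sgn h * x) ≈⟨ *-assoc _ _ _ ⟨
    sgn h * sgn h * x   ≈⟨ *-congʳ (sgn*sgn≈1 h) ⟩
    1# * x              ≈⟨ *-identityˡ x ⟩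
    x                   ∎

  δ : ℕ → ℕ → Carrier
  δ zero    zero    = 1#
  δ zero    (suc l) = 0#
  δ (suc m) zero    = 0#
  δ (suc m) (suc l) = δ m l

  δ-diag : ∀ m → δ m m ≡ 1#
  δ-diag zero    = ≡.refl
  δ-diag (suc m) = δ-diag m

  δ-off : ∀ m l → m ≢ l → δ m l ≈ 0#
  δ-off zero    zero    m≢l = contradiction ≡.refl m≢l
  δ-off zero    (suc l) _   = refl
  δ-off (suc m) zero    _   = refl
  δ-off (suc m) (suc l) m≢l = δ-off m l (m≢l ∘ ≡.cong suc)

  nat-+ : ∀ a b → nat (a ℕ.+ b) ≈ nat a + nat b
  nat-+ zero    b = sym (+-identityˡ (nat b))
  nat-+ (suc a) b = trans (+-congˡ (nat-+ a b)) (sym (+-assoc 1# (nat a) (nat b)))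

  nat-pascal : ∀ m k → nat (suc m C suc k) ≈ nat (m C k) + nat (m C suc k)
  nat-pascal m k = trans (reflexive (≡.cong nat (≡.sym (nCk+nC[k+1]≡[n+1]C[k+1] m k))))
                         (nat-+ (m C k) (m C suc k))

  Δ : (N : ℕ) → (Fin N → Carrier) → ℕ → Carrier
  Δ N x m = ∑[ h < N ] (sgn (toℕ h) * (nat (m C toℕ h) * x h))

  Δ-cong : ∀ {N} {x y : Fin N → Carrier} → (∀ h → x h ≈ y h) → ∀ m → Δ N x m ≈ Δ N y m
  Δ-cong {N} x≈y m = sum-cong-≋ {N} (λ h → *-congˡ (*-congˡ (x≈y h)))

  Δ-+ : ∀ {N} (x y : Fin N → Carrier) m → Δ N (λ h → x h + y h) m ≈ Δ N x m + Δ N y m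
  Δ-+ {N} x y m = trans (sum-cong-≋ {N} (λ h → trans (*-congˡ (distribˡ _ _ _)) (distribˡ _ _ _)))
                        (∑-distrib-+ {N} _ _)

  Δ-zero : ∀ N m → Δ N (λ _ → 0#) m ≈ 0#
  Δ-zero N m = sum-zero {N} _ (λ h → trans (*-congˡ (zeroʳ _)) (zeroʳ _))

  Δ-row₀ : ∀ {N} (x : Fin (suc N) → Carrier) → Δ (suc N) x 0 ≈ x zero
  Δ-row₀ {N} x = begin
    Δ (suc N) x 0
      ≈⟨ +-cong (*-identityˡ _) (sum-zero {N} _ (λ _ → trans (*-congˡ (zeroˡ _)) (zeroʳ _))) ⟩
    (1# + 0#) * x zero + 0#     ≈⟨ +-identityʳ _ ⟩
    (1# + 0#) * x zero          ≈⟨ *-congʳ (+-identityʳ 1#) ⟩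
    1# * x zero                 ≈⟨ *-identityˡ _ ⟩
    x zero                      ∎

  Δ-pascal : ∀ {N} (x : Fin (suc N) → Carrier) m →
             Δ (suc N) x (suc m) + Δ N (x ∘ suc) m ≈ Δ (suc N) x m
  Δ-pascal {N} x m = begin
    (x₀ + ∑[ k < N ] b′ k) + ∑[ k < N ] a k   ≈⟨ +-assoc x₀ _ _ ⟩
    x₀ + (∑[ k < N ] b′ k + ∑[ k < N ] a k)   ≈⟨ +-congˡ (∑-distrib-+ {N} b′ a) ⟨
    x₀ + ∑[ k < N ] (b′ k + a k)              ≈⟨ +-congˡ (sum-cong-≋ {N} merge) ⟩
    x₀ + ∑[ k < N ] b k                       ∎
    where
    x₀ = sgn 0 * (nat (m C 0) * x zero)
    a b b′ : Fin N → Carrier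
    a  k = sgn (toℕ k) * (nat (m C toℕ k) * x (suc k))
    b  k = - sgn (toℕ k) * (nat (m C suc (toℕ k)) * x (suc k))
    b′ k = - sgn (toℕ k) * (nat (suc m C suc (toℕ k)) * x (suc k))
    merge : ∀ k → b′ k + a k ≈ b k
    merge k = begin
      - g * (nat (suc m C suc j) * y) + a k
        ≈⟨ +-congʳ (*-congˡ (*-congʳ (nat-pascal m j))) ⟩
      - g * ((u + v) * y) + g * (u * y)
        ≈⟨ solve 5 (λ g′ g u v y → g′ :* ((u :+ v) :* y) :+ g :* (u :* y)
                                := g′ :* (v :* y) :+ (g′ :+ g) :* (u :* y))
                   refl (- g) g u v y ⟩
      b k + (- g + g) * (u * y)  ≈⟨ +-congˡ (trans (*-congʳ (-‿inverseˡ g)) (zeroˡ _)) ⟩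
      b k + 0#                   ≈⟨ +-identityʳ (b k) ⟩
      b k                        ∎
      where
      j = toℕ k
      g = sgn j
      u = nat (m C j)
      v = nat (m C suc j)
      y = x (suc k)

  x-[y+x]≈-y : ∀ x y → x - (y + x) ≈ - y
  x-[y+x]≈-y x y = begin
    x - (y + x)         ≈⟨ +-congˡ (⁻¹-∙-comm y x) ⟨
    x + (- y - x)       ≈⟨ solve 3 (λ x a b → x :+ (a :+ b) := a :+ (x :+ b)) refl x (- y) (- x) ⟩
    - y + (x - x)       ≈⟨ +-congˡ (-‿inverseʳ x) ⟩
    - y + 0#            ≈⟨ +-identityʳ (- y) ⟩
    - y                 ∎

  column : ∀ {N} → ℕ → Fin N → Carrier
  column l h = nat (toℕ h C l)

  Δ-column : ∀ N m l → m < N → Δ N (column l) m ≈ sgn m * δ m l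
  Δ-column (suc N) zero    zero    _         =
    trans (Δ-row₀ (column {suc N} 0)) (trans (+-identityʳ 1#) (sym (*-identityˡ 1#)))
  Δ-column (suc N) zero    (suc l) _         =
    trans (Δ-row₀ (column {suc N} (suc l))) (sym (zeroʳ 1#))
  Δ-column (suc N) (suc m) l       (s≤s m<N) = begin
    Δ (suc N) (column l) (suc m)                     ≈⟨ x+y≈z⇒x≈z-y (Δ-pascal (column {suc N} l) m) ⟩
    Δ (suc N) (column l) m - Δ N (column l ∘ suc) m  ≈⟨ +-congʳ (Δ-column (suc N) m l (m<n⇒m<1+n m<N)) ⟩
    sgn m * δ m l - Δ N (column l ∘ suc) m           ≈⟨ shifted l ⟩
    - sgn m * δ (suc m) l                            ∎
    where
    shifted : ∀ l → sgn m * δ m l - Δ N (column l ∘ suc) m ≈ - sgn m * δ (suc m) l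
    shifted zero = begin
      sgn m * δ m 0 - Δ N (column 0) m       ≈⟨ +-congˡ (-‿cong (Δ-column N m 0 m<N)) ⟩
      sgn m * δ m 0 - sgn m * δ m 0          ≈⟨ -‿inverseʳ _ ⟩
      0#                                     ≈⟨ zeroʳ (- sgn m) ⟨
      - sgn m * 0#                           ∎
    shifted (suc l) = begin
      sgn m * δ m (suc l) - Δ N (column (suc l) ∘ suc) m
        ≈⟨ +-congˡ (-‿cong (Δ-cong {N} (λ h → nat-pascal (toℕ h) l) m)) ⟩
      sgn m * δ m (suc l) - Δ N (λ h → column l h + column (suc l) h) m
        ≈⟨ +-congˡ (-‿cong (trans (Δ-+ (column {N} l) (column (suc l)) m)
                                  (+-cong (Δ-column N m l m<N) (Δ-column N m (suc l) m<N)))) ⟩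
      sgn m * δ m (suc l) - (sgn m * δ m l + sgn m * δ m (suc l))
        ≈⟨ x-[y+x]≈-y _ _ ⟩
      - (sgn m * δ m l)                      ≈⟨ -‿distribˡ-* (sgn m) (δ m l) ⟩
      - sgn m * δ m l                        ∎

  Δ-involutive : ∀ {p} (x : Fin p → Carrier) i → Δ p (λ l → Δ p x (toℕ l)) (toℕ i) ≈ x i
  Δ-involutive {p} x i = begin
    ∑[ l < p ] (sgn (toℕ l) * (nat (toℕ i C toℕ l) * Δ p x (toℕ l)))  ≈⟨ sum-cong-≋ {p} expand ⟩
    ∑[ l < p ] ∑[ h < p ] (w h * t l h)                                ≈⟨ ∑-comm {p} {p} _ ⟩
    ∑[ h < p ] ∑[ l < p ] (w h * t l h)
      ≈⟨ sum-cong-≋ {p} (λ h → *-distribˡ-sum (w h) (λ l → t l h)) ⟨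
    ∑[ h < p ] (w h * Δ p (column (toℕ h)) (toℕ i))
      ≈⟨ sum-cong-≋ {p} (λ h → *-congˡ (Δ-column p (toℕ i) (toℕ h) (toℕ<n i))) ⟩
    ∑[ h < p ] (w h * (sgn (toℕ i) * δ (toℕ i) (toℕ h)))  ≈⟨ sum-single _ i off-diagonal ⟩
    w i * (sgn (toℕ i) * δ (toℕ i) (toℕ i))
      ≡⟨ ≡.cong (λ d → w i * (sgn (toℕ i) * d)) (δ-diag (toℕ i)) ⟩
    w i * (sgn (toℕ i) * 1#)                              ≈⟨ *-congˡ (*-identityʳ _) ⟩
    sgn (toℕ i) * x i * sgn (toℕ i)                       ≈⟨ *-comm _ _ ⟩
    sgn (toℕ i) * (sgn (toℕ i) * x i)                     ≈⟨ sgn-cancel (toℕ i) (x i) ⟩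
    x i                                                   ∎
    where
    w : Fin p → Carrier
    w h = sgn (toℕ h) * x h
    t : Fin p → Fin p → Carrier
    t l h = sgn (toℕ l) * (nat (toℕ i C toℕ l) * column (toℕ h) l)
    expand : ∀ l → sgn (toℕ l) * (nat (toℕ i C toℕ l) * Δ p x (toℕ l)) ≈ ∑[ h < p ] (w h * t l h)
    expand l = begin
      g * (b * Δ p x (toℕ l))                                 ≈⟨ *-congˡ (*-distribˡ-sum {p} _ _) ⟩
      g * ∑[ h < p ] (b * (sgn (toℕ h) * (column (toℕ h) l * x h))) ≈⟨ *-distribˡ-sum {p} _ _ ⟩
      ∑[ h < p ] (g * (b * (sgn (toℕ h) * (column (toℕ h) l * x h))))
        ≈⟨ sum-cong-≋ {p} (λ h →
             solve 5 (λ g b g′ b′ y → g :* (b :* (g′ :* (b′ :* y))) := (g′ :* y) :* (g :* (b :* b′)))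
                     refl g b (sgn (toℕ h)) (column (toℕ h) l) (x h)) ⟩
      ∑[ h < p ] (w h * t l h)                                ∎
      where
      g = sgn (toℕ l)
      b = nat (toℕ i C toℕ l)
    off-diagonal : ∀ h → h ≢ i → w h * (sgn (toℕ i) * δ (toℕ i) (toℕ h)) ≈ 0#
    off-diagonal h h≢i =
      trans (*-congˡ (trans (*-congˡ (δ-off _ _ (h≢i ∘ toℕ-injective ∘ ≡.sym))) (zeroʳ _))) (zeroʳ _)

module BinomialBasis {c ℓ} (R : CommutativeRing c ℓ) (s : CommutativeRing.Carrier R)
                     (p : ℕ) (α : Fin p → ℕ) where
  open CommutativeRing R hiding (zero)
  open Ops R
  open BinomialTransform R
  open import Algebra.Properties.Semiring.Sum semiring using (sum-syntax; sum-cong-≋)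
  open import Relation.Binary.Reasoning.Setoid setoid
  open SemiringSolver commutativeSemiring using (solve; _:=_; _:*_)

  ValGe-resp : ∀ {y y′ n} → y ≈ y′ → ValGe s y n → ValGe s y′ n
  ValGe-resp y≈y′ (z , y≈zsⁿ) = z , trans (sym y≈y′) y≈zsⁿ

  alternatingSum≈Δ : ∀ (x : Fin p → Carrier) m →
    sumFin p (λ h → signMul (toℕ h) (nat (m C toℕ h) * x h)) ≈ Δ p x m
  alternatingSum≈Δ x m =
    trans (reflexive (sumFin≡sum p _)) (sum-cong-≋ {p} (λ h → signMul≈sgn* (toℕ h) _))

  InM⇒Δ-divisible : ∀ {x} → InM s p α x → ∀ l → ValGe s (Δ p x (toℕ l)) (α l)
  InM⇒Δ-divisible {x} x∈M l = ValGe-resp {n = α l} (alternatingSum≈Δ x (toℕ l)) (x∈M l)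

  Δ-divisible⇒InM : ∀ {x} → (∀ l → ValGe s (Δ p x (toℕ l)) (α l)) → InM s p α x
  Δ-divisible⇒InM {x} H l = ValGe-resp {n = α l} (sym (alternatingSum≈Δ x (toℕ l))) (H l)

  combination : (Fin p → Carrier) → Fin p → Carrier
  combination a i = sumFin p (λ l → a l * vec s p α l i)

  combination≈Δ : ∀ a i → combination a i ≈ Δ p (λ l → sgn (toℕ l) * (a l * pow s (α l))) (toℕ i)
  combination≈Δ a i = trans (reflexive (sumFin≡sum p _)) (sum-cong-≋ {p} (λ l →
    trans (sym (sgn-cancel (toℕ l) _))
          (solve 4 (λ g a q b → g :* (g :* (a :* (q :* b))) := g :* (b :* (g :* (a :* q))))
            refl (sgn (toℕ l)) (a l) (pow s (α l)) (nat (toℕ i C toℕ l)))))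

  combination∈M : ∀ a → InM s p α (combination a)
  combination∈M a = Δ-divisible⇒InM (λ l → sgn (toℕ l) * a l , (begin
    Δ p (combination a) (toℕ l)                ≈⟨ Δ-cong (combination≈Δ a) (toℕ l) ⟩
    Δ p (λ j → Δ p y (toℕ j)) (toℕ l)          ≈⟨ Δ-involutive y l ⟩
    sgn (toℕ l) * (a l * pow s (α l))          ≈⟨ *-assoc _ _ _ ⟨
    sgn (toℕ l) * a l * pow s (α l)            ∎))
    where
    y : Fin p → Carrier
    y l = sgn (toℕ l) * (a l * pow s (α l))

  vec≈combination : ∀ k i → vec s p α k i ≈ combination (λ l → δ (toℕ k) (toℕ l)) i
  vec≈combination k i = sym (begin
    combination (λ l → δ (toℕ k) (toℕ l)) i         ≡⟨ sumFin≡sum p _ ⟩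
    ∑[ l < p ] (δ (toℕ k) (toℕ l) * vec s p α l i)  ≈⟨ sum-single _ k off-diagonal ⟩
    δ (toℕ k) (toℕ k) * vec s p α k i               ≡⟨ ≡.cong (_* vec s p α k i) (δ-diag (toℕ k)) ⟩
    1# * vec s p α k i                              ≈⟨ *-identityˡ _ ⟩
    vec s p α k i                                   ∎)
    where
    off-diagonal : ∀ l → l ≢ k → δ (toℕ k) (toℕ l) * vec s p α l i ≈ 0#
    off-diagonal l l≢k = trans (*-congʳ (δ-off _ _ (l≢k ∘ ≡.sym ∘ toℕ-injective))) (zeroˡ _)

  InM-resp : ∀ {x y} → (∀ i → x i ≈ y i) → InM s p α x → InM s p α y
  InM-resp x≈y x∈M =
    Δ-divisible⇒InM (λ l → ValGe-resp {n = α l} (Δ-cong x≈y (toℕ l)) (InM⇒Δ-divisible x∈M l))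

  vec∈M : ∀ k → InM s p α (vec s p α k)
  vec∈M k = InM-resp (λ i → sym (vec≈combination k i)) (combination∈M _)

  M⊆span : ∀ x → InM s p α x → Σ (Fin p → Carrier) λ a → ∀ i → x i ≈ combination a i
  M⊆span x x∈M = a , λ i → begin
    x i                                                    ≈⟨ Δ-involutive x i ⟨
    Δ p (λ l → Δ p x (toℕ l)) (toℕ i)                      ≈⟨ Δ-cong rescale (toℕ i) ⟩
    Δ p (λ l → sgn (toℕ l) * (a l * pow s (α l))) (toℕ i)  ≈⟨ combination≈Δ a i ⟨
    combination a i                                        ∎
    where
    z : Fin p → Carrier
    z l = proj₁ (InM⇒Δ-divisible x∈M l)
    a : Fin p → Carrier
    a l = sgn (toℕ l) * z l
    rescale : ∀ l → Δ p x (toℕ l) ≈ sgn (toℕ l) * (a l * pow s (α l))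
    rescale l = begin
      Δ p x (toℕ l)                                      ≈⟨ proj₂ (InM⇒Δ-divisible x∈M l) ⟩
      z l * pow s (α l)                                  ≈⟨ sgn-cancel (toℕ l) _ ⟨
      sgn (toℕ l) * (sgn (toℕ l) * (z l * pow s (α l)))  ≈⟨ *-congˡ (*-assoc _ _ _) ⟨
      sgn (toℕ l) * (a l * pow s (α l))                  ∎

  vec-independent : (∀ n y → y * pow s n ≈ 0# → y ≈ 0#) →
    ∀ a → (∀ i → combination a i ≈ 0#) → ∀ l → a l ≈ 0#
  vec-independent pow-cancel a a·v≈0 l = pow-cancel (α l) (a l) (begin
    a l * pow s (α l)                     ≈⟨ sgn-cancel (toℕ l) _ ⟨
    sgn (toℕ l) * y l                     ≈⟨ *-congˡ (y≈0 l) ⟩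
    sgn (toℕ l) * 0#                      ≈⟨ zeroʳ _ ⟩
    0#                                    ∎)
    where
    y : Fin p → Carrier
    y l = sgn (toℕ l) * (a l * pow s (α l))
    y≈0 : ∀ l → y l ≈ 0#
    y≈0 l = begin
      y l                                 ≈⟨ Δ-involutive y l ⟨
      Δ p (λ j → Δ p y (toℕ j)) (toℕ l)
        ≈⟨ Δ-cong (λ j → trans (sym (combination≈Δ a j)) (a·v≈0 j)) (toℕ l) ⟩
      Δ p (λ _ → 0#) (toℕ l)              ≈⟨ Δ-zero p (toℕ l) ⟩
      0#                                  ∎

  isBasis : (∀ n y → y * pow s n ≈ 0# → y ≈ 0#) → IsBasis p (InM s p α) (vec s p α)
  isBasis pow-cancel = vec∈M , vec-independent pow-cancel , M⊆span

module DVR {c ℓ} (R : CommutativeRing c ℓ) {s : CommutativeRing.Carrier R} (dvr : Ops.IsDVR R s) where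
  open CommutativeRing R hiding (zero)
  open Ops R
  open IsDVR dvr

  pow≉0 : ∀ n → ¬ (pow s n ≈ 0#)
  pow≉0 zero    = nontrivial
  pow≉0 (suc n) sⁿ⁺¹≈0 with noZeroDiv s (pow s n) sⁿ⁺¹≈0
  ... | inj₁ s≈0  = s≉0 s≈0
  ... | inj₂ sⁿ≈0 = pow≉0 n sⁿ≈0

  pow-cancel : ∀ n y → y * pow s n ≈ 0# → y ≈ 0#
  pow-cancel n y ysⁿ≈0 with noZeroDiv y (pow s n) ysⁿ≈0
  ... | inj₁ y≈0  = y≈0
  ... | inj₂ sⁿ≈0 = contradiction sⁿ≈0 (pow≉0 n)

lemma1p16 : ∀ {c ℓ} (S : CommutativeRing c ℓ) (s : CommutativeRing.Carrier S) →
    Ops.IsDVR S s → (p : ℕ) → Prime p → (α : Fin p → ℕ) →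
    Ops.IsBasis S p (Ops.InM S s p α) (Ops.vec S s p α)
lemma1p16 S s dvr p _ α = BinomialBasis.isBasis S s p α (DVR.pow-cancel S dvr)
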